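{- Let $k$ be a positive integer and $n=2k$. Then $rn(C_n\square C_n)\ge \frac{n^2-2}{2}(k+2)+2$.
   Context: $C_n$ is the cycle graph with vertex set $\{0,\dots,n-1\}$, $v,w$ adjacent iff $v\equiv w\pm1 \pmod n$. The Cartesian product $G\square H$ has vertex set $V(G)\times V(H)$, with $(g,h)\sim(g',h')$ iff ($g=g'$ and $hh'\in E(H)$) or ($h=h'$ and $gg'\in E(G)$). $d(u,v)$ is graph distance and $\operatorname{diam}(G)$ the maximum distance in $G$. A radio labeling of a connected graph $G$ is a function $c:V(G)\to\{1,2,\dots\}$ with $d(u,v)+|c(u)-c(v)|\ge 1+\operatorname{diam}(G)$ for all distinct $u,v$. The span of $c$ is its maximum value; the radio number $rn(G)$ is the minimum span over all radio labelings of $G$. -}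

module Defs where

open import Data.Nat using (ℕ; zero; suc; _+_; _*_; _≤_; _⊔_; ∣_-_∣; NonZero; _%_)
open import Data.Nat.Properties using (m*n≢0)
open import Data.Fin using (Fin; toℕ)
open import Data.Product using (_×_; _,_; Σ; ∃)
open import Data.Sum using (_⊎_)
open import Data.List using (List; map; foldr; allFin; cartesianProduct)
open import Relation.Binary.PropositionalEquality using (_≡_; _≢_)
open import Relation.Nullary using (¬_)

Graph : Set → Set₁
Graph V = V → V → Set

data Walk {V : Set} (E : Graph V) : V → V → ℕ → Set where
  nil  : ∀ {u} → Walk E u u 0
  cons : ∀ {u w v ℓ} → E u w → Walk E w v ℓ → Walk E u v (suc ℓ)

IsDist : {V : Set} → Graph V → V → V → ℕ → Set
IsDist E u v m = Walk E u v m × (∀ ℓ → Walk E u v ℓ → m ≤ ℓ)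

IsDiam : {V : Set} → Graph V → ℕ → Set
IsDiam {V} E D =
  (∀ u v → ∃ λ m → IsDist E u v m × m ≤ D) × (∃ λ u → ∃ λ v → IsDist E u v D)

IsRadioLabeling : {V : Set} → Graph V → ℕ → (V → ℕ) → Set
IsRadioLabeling {V} E D c =
  (∀ v → 1 ≤ c v) ×
  (∀ u v → u ≢ v → ∀ m → IsDist E u v m → 1 + D ≤ m + ∣ c u - c v ∣)

C : (n : ℕ) → .{{NonZero n}} → Graph (Fin n)
C n v w = toℕ v ≡ (toℕ w + 1) % n ⊎ toℕ w ≡ (toℕ v + 1) % n

_□_ : {A B : Set} → Graph A → Graph B → Graph (A × B)
(G □ H) (g , h) (g' , h') = (g ≡ g' × H h h') ⊎ (h ≡ h' × G g g')

torusVertices : (n : ℕ) → List (Fin n × Fin n)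
torusVertices n = cartesianProduct (allFin n) (allFin n)

torusSpan : (n : ℕ) → (Fin n × Fin n → ℕ) → ℕ
torusSpan n c = foldr _⊔_ 0 (map c (torusVertices n))

instance
  2*-nonZero : ∀ {k} → .{{NonZero k}} → NonZero (2 * k)
  2*-nonZero {k} = m*n≢0 2 k

-- The potential (a, b) ↦ min(a, n − a) + min(b, n − b) changes by at most 1 along an edge,
-- so the diameter D of C_n □ C_n (n = 2k) is at least 2k. Any three vertices x, y, z lie on a
-- closed walk of length at most 2n (at most n in each coordinate), so d(x,y) + d(y,z) + d(z,x) ≤ 4k.
-- If c z < c y < c x, then either d(x,y) + d(y,z) ≤ 3k and adding the radio conditions for (x,y)
-- and (y,z) gives c x − c z ≥ k + 2, or d(z,x) < k and the radio condition for (z,x) alone gives it.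
-- Radio labels are distinct, so in increasing order the n² labels start with values ≥ 1, ≥ 2 and
-- then grow by at least k + 2 every two steps.
module Submission where

open import Defs
open import Data.Nat using (ℕ; zero; suc; _+_; _*_; _∸_; _/_; _%_; _≤_; _<_; _⊓_; _⊔_; ∣_-_∣; NonZero; >-nonZero⁻¹; z≤n; s≤s; s≤s⁻¹; _≤?_)
open import Data.Nat.Properties
open import Data.Nat.DivMod using (n%n≡0; m%n<n; m<n⇒m%n≡m; [m+n]%n≡m%n; [m+kn]%n≡m%n; m≡m%n+[m/n]*n; m/n*n≤m)
open import Algebra.Properties.CommutativeSemigroup +-commutativeSemigroup using (x∙yz≈y∙xz)
open import Data.Nat.Tactic.RingSolver using (solve-∀)
open import Data.Fin using (Fin; toℕ; fromℕ<)
open import Data.Fin.Properties using (toℕ-fromℕ<; toℕ-injective; toℕ<n)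
open import Data.Product using (∃-syntax; _×_; _,_; proj₁; proj₂)
open import Data.Sum using (inj₁; inj₂)
open import Data.List using (List; []; _∷_; length; map; foldr; allFin; cartesianProductWith)
open import Data.List.Properties using (length-++; length-map; length-tabulate)
open import Data.List.Membership.Propositional using (_∈_)
open import Data.List.Relation.Unary.Any using (here; there)
open import Data.List.Relation.Unary.All using (_∷_)
open import Data.List.Relation.Unary.AllPairs using (_∷_)
open import Data.List.Relation.Unary.Linked using (Linked; []; [-]; _∷_)
open import Data.List.Relation.Unary.Unique.Propositional using (Unique)
open import Data.List.Relation.Unary.Unique.Propositional.Properties using (cartesianProduct⁺; allFin⁺)
open import Data.List.Relation.Binary.Permutation.Propositional using (↭-sym; ↭⇒↭ₛ)
open import Data.List.Relation.Binary.Permutation.Propositional.Properties using (∈-resp-↭; ↭-length)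
import Data.List.Relation.Binary.Permutation.Setoid.Properties as Permutationₛ
import Data.List.Sort as Sort
import Relation.Binary.Construct.On as On
open import Relation.Binary.Definitions using (Symmetric)
open import Function using (id)
open import Relation.Nullary using (yes; no)
open import Relation.Binary.PropositionalEquality

module _ {V : Set} {E : Graph V} where

  walk-++ : ∀ {u w v a b} → Walk E u w a → Walk E w v b → Walk E u v (a + b)
  walk-++ nil q = q
  walk-++ (cons e p) q = cons e (walk-++ p q)

  walk-snoc : ∀ {u w v a} → Walk E u w a → E w v → Walk E u v (suc a)
  walk-snoc nil e = cons e nil
  walk-snoc (cons e′ p) e = cons e′ (walk-snoc p e)

  walk-reverse : Symmetric E → ∀ {u v a} → Walk E u v a → Walk E v u a
  walk-reverse sym nil = nil
  walk-reverse sym (cons e p) = walk-snoc (walk-reverse sym p) (sym e)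

data Triangle {V : Set} (E : Graph V) (p : ℕ) (a b c : V) : Set where
  triangle : ∀ {ℓ₁ ℓ₂ ℓ₃} → Walk E a b ℓ₁ → Walk E b c ℓ₂ → Walk E c a ℓ₃ →
             ℓ₁ + ℓ₂ + ℓ₃ ≤ p → Triangle E p a b c

module _ {V : Set} {E : Graph V} {p : ℕ} where

  triangle-rotate : ∀ {a b c} → Triangle E p a b c → Triangle E p b c a
  triangle-rotate (triangle {ℓ₁} {ℓ₂} {ℓ₃} ab bc ca ≤p) =
    triangle bc ca ab (≤-trans (≤-reflexive (rotation ℓ₁ ℓ₂ ℓ₃)) ≤p)
    where
    rotation : ∀ x y z → y + z + x ≡ x + y + z
    rotation = solve-∀

  triangle-reflect : Symmetric E → ∀ {a b c} → Triangle E p a b c → Triangle E p a c b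
  triangle-reflect sym (triangle {ℓ₁} {ℓ₂} {ℓ₃} ab bc ca ≤p) =
    triangle (walk-reverse sym ca) (walk-reverse sym bc) (walk-reverse sym ab)
      (≤-trans (≤-reflexive (reflection ℓ₁ ℓ₂ ℓ₃)) ≤p)
    where
    reflection : ∀ x y z → z + y + x ≡ x + y + z
    reflection = solve-∀

  triangle-distances : ∀ {a b c m₁ m₂ m₃} → Triangle E p a b c →
    IsDist E a b m₁ → IsDist E b c m₂ → IsDist E c a m₃ → m₁ + m₂ + m₃ ≤ p
  triangle-distances (triangle ab bc ca ≤p) (_ , min₁) (_ , min₂) (_ , min₃) =
    ≤-trans (+-mono-≤ (+-mono-≤ (min₁ _ ab) (min₂ _ bc)) (min₃ _ ca)) ≤p

module _ {A B : Set} {G : Graph A} {H : Graph B} where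

  walk-□ˡ : ∀ {a a′ ℓ} (b : B) → Walk G a a′ ℓ → Walk (G □ H) (a , b) (a′ , b) ℓ
  walk-□ˡ b nil = nil
  walk-□ˡ b (cons e p) = cons (inj₂ (refl , e)) (walk-□ˡ b p)

  walk-□ʳ : ∀ {b b′ ℓ} (a : A) → Walk H b b′ ℓ → Walk (G □ H) (a , b) (a , b′) ℓ
  walk-□ʳ a nil = nil
  walk-□ʳ a (cons e p) = cons (inj₁ (refl , e)) (walk-□ʳ a p)

  walk-□ : ∀ {a a′ b b′ ℓ m} → Walk G a a′ ℓ → Walk H b b′ m → Walk (G □ H) (a , b) (a′ , b′) (ℓ + m)
  walk-□ {a′ = a′} {b = b} p q = walk-++ (walk-□ˡ b p) (walk-□ʳ a′ q)

  triangle-□ : ∀ {p q a₁ a₂ a₃ b₁ b₂ b₃} → Triangle G p a₁ a₂ a₃ → Triangle H q b₁ b₂ b₃ →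
               Triangle (G □ H) (p + q) (a₁ , b₁) (a₂ , b₂) (a₃ , b₃)
  triangle-□ (triangle {ℓ₁} {ℓ₂} {ℓ₃} p₁ p₂ p₃ ≤p) (triangle {m₁} {m₂} {m₃} q₁ q₂ q₃ ≤q) =
    triangle (walk-□ p₁ q₁) (walk-□ p₂ q₂) (walk-□ p₃ q₃)
      (≤-trans (≤-reflexive (interchange ℓ₁ ℓ₂ ℓ₃ m₁ m₂ m₃)) (+-mono-≤ ≤p ≤q))
    where
    interchange : ∀ a b c d e f → a + d + (b + e) + (c + f) ≡ a + b + c + (d + e + f)
    interchange = solve-∀

Lipschitz : {V : Set} → Graph V → (V → ℕ) → Set
Lipschitz E f = ∀ {u w} → E u w → f u ≤ suc (f w)

module _ {V : Set} {E : Graph V} {f : V → ℕ} (lip : Lipschitz E f) where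

  lipschitz-walk : ∀ {u v ℓ} → Walk E u v ℓ → f u ≤ ℓ + f v
  lipschitz-walk nil = ≤-refl
  lipschitz-walk (cons e p) = ≤-trans (lip e) (s≤s (lipschitz-walk p))

  lipschitz-diam : ∀ {D} → IsDiam E D → ∀ u v → f u ≤ D + f v
  lipschitz-diam (dist , _) u v with dist u v
  ... | m , (walk , _) , m≤D = ≤-trans (lipschitz-walk walk) (+-monoˡ-≤ (f v) m≤D)

lipschitz-□ : ∀ {A B : Set} {G : Graph A} {H : Graph B} {f : A → ℕ} {g : B → ℕ} →
  Lipschitz G f → Lipschitz H g → Lipschitz (G □ H) (λ x → f (proj₁ x) + g (proj₂ x))
lipschitz-□ {f = f} lipG lipH (inj₁ (refl , e)) = ≤-trans (+-monoʳ-≤ (f _) (lipH e)) (≤-reflexive (+-suc _ _))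
lipschitz-□ {g = g} lipG lipH (inj₂ (refl , e)) = +-monoˡ-≤ (g _) (lipG e)

m∸n≤1+[m∸[1+n]] : ∀ m n → m ∸ n ≤ suc (m ∸ suc n)
m∸n≤1+[m∸[1+n]] zero zero = z≤n
m∸n≤1+[m∸[1+n]] zero (suc n) = z≤n
m∸n≤1+[m∸[1+n]] (suc m) zero = ≤-refl
m∸n≤1+[m∸[1+n]] (suc m) (suc n) = m∸n≤1+[m∸[1+n]] m n

module Cycle (n : ℕ) .{{_ : NonZero n}} where

  C-symmetric : Symmetric (C n)
  C-symmetric (inj₁ p) = inj₂ p
  C-symmetric (inj₂ p) = inj₁ p

  [m%n+d]%n≡[m+d]%n : ∀ m d → (m % n + d) % n ≡ (m + d) % n
  [m%n+d]%n≡[m+d]%n m d = begin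
    (m % n + d) % n             ≡⟨ [m+kn]%n≡m%n (m % n + d) (m / n) n ⟨
    (m % n + d + m / n * n) % n ≡⟨ cong (_% n) (x+y+z≡x+z+y (m % n) d (m / n * n)) ⟩
    (m % n + m / n * n + d) % n ≡⟨ cong (λ t → (t + d) % n) (m≡m%n+[m/n]*n m n) ⟨
    (m + d) % n                 ∎
    where
    open ≡-Reasoning
    x+y+z≡x+z+y : ∀ x y z → x + y + z ≡ x + z + y
    x+y+z≡x+z+y = solve-∀

  successor : Fin n → Fin n
  successor u = fromℕ< (m%n<n (toℕ u + 1) n)

  walk-forward : ∀ d {u v} → (toℕ u + d) % n ≡ toℕ v → Walk (C n) u v d
  walk-forward zero {u} {v} eq = subst (λ w → Walk (C n) u w 0) (toℕ-injective u≡v) nil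
    where
    u≡v : toℕ u ≡ toℕ v
    u≡v = trans (sym (m<n⇒m%n≡m (toℕ<n u))) (trans (cong (_% n) (sym (+-identityʳ (toℕ u)))) eq)
  walk-forward (suc d) {u} {v} eq = cons (inj₂ toℕ-successor) (walk-forward d eq′)
    where
    toℕ-successor : toℕ (successor u) ≡ (toℕ u + 1) % n
    toℕ-successor = toℕ-fromℕ< _
    eq′ : (toℕ (successor u) + d) % n ≡ toℕ v
    eq′ = trans (cong (λ t → (t + d) % n) toℕ-successor)
         (trans ([m%n+d]%n≡[m+d]%n (toℕ u + 1) d) (trans (cong (_% n) (+-assoc (toℕ u) 1 d)) eq))

  walk-up : ∀ d {u v} → toℕ u + d ≡ toℕ v → Walk (C n) u v d
  walk-up d {v = v} eq = walk-forward d (trans (cong (_% n) eq) (m<n⇒m%n≡m (toℕ<n v)))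

  walk-around : ∀ d {u v} → toℕ u + d ≡ toℕ v + n → Walk (C n) u v d
  walk-around d {v = v} eq =
    walk-forward d (trans (cong (_% n) eq) (trans ([m+n]%n≡m%n (toℕ v) n) (m<n⇒m%n≡m (toℕ<n v))))

  -- Once around the cycle: up from a to b, up from b to c, then across 0 back to a.
  triangle-ordered : ∀ {a b c} → toℕ a ≤ toℕ b → toℕ b ≤ toℕ c → Triangle (C n) n a b c
  triangle-ordered {a} {b} {c} a≤b b≤c
    with i , a+i≡b ← m≤n⇒∃[o]m+o≡n a≤b
       | j , b+j≡c ← m≤n⇒∃[o]m+o≡n b≤c
       | f , c+f≡n ← m≤n⇒∃[o]m+o≡n (toℕ<n c) =
    triangle (walk-up i a+i≡b) (walk-up j b+j≡c) (walk-around (suc f + toℕ a) wraps) (≤-reflexive once)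
    where
    open ≡-Reasoning
    wraps : toℕ c + (suc f + toℕ a) ≡ toℕ a + n
    wraps = begin
      toℕ c + (suc f + toℕ a) ≡⟨ x+[1+y+z]≡z+[1+x+y] (toℕ c) f (toℕ a) ⟩
      toℕ a + (suc (toℕ c) + f) ≡⟨ cong (toℕ a +_) c+f≡n ⟩
      toℕ a + n ∎
      where
      x+[1+y+z]≡z+[1+x+y] : ∀ x y z → x + (suc y + z) ≡ z + (suc x + y)
      x+[1+y+z]≡z+[1+x+y] = solve-∀
    once : i + j + (suc f + toℕ a) ≡ n
    once = begin
      i + j + (suc f + toℕ a)   ≡⟨ y+z+[1+w+x]≡1+x+y+z+w (toℕ a) i j f ⟩
      suc (toℕ a + i + j) + f   ≡⟨ cong (λ t → suc (t + j) + f) a+i≡b ⟩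
      suc (toℕ b + j) + f       ≡⟨ cong (λ t → suc t + f) b+j≡c ⟩
      suc (toℕ c) + f           ≡⟨ c+f≡n ⟩
      n                         ∎
      where
      y+z+[1+w+x]≡1+x+y+z+w : ∀ x y z w → y + z + (suc w + x) ≡ suc (x + y + z) + w
      y+z+[1+w+x]≡1+x+y+z+w = solve-∀

  cycle-triangle : ∀ a b c → Triangle (C n) n a b c
  cycle-triangle a b c with ≤-total (toℕ a) (toℕ b) | ≤-total (toℕ b) (toℕ c) | ≤-total (toℕ a) (toℕ c)
  ... | inj₁ a≤b | inj₁ b≤c | _        = triangle-ordered a≤b b≤c
  ... | inj₁ a≤b | inj₂ c≤b | inj₁ a≤c = triangle-reflect C-symmetric (triangle-ordered a≤c c≤b)
  ... | inj₁ a≤b | inj₂ c≤b | inj₂ c≤a = triangle-rotate (triangle-ordered c≤a a≤b)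
  ... | inj₂ b≤a | inj₁ b≤c | inj₁ a≤c = triangle-rotate (triangle-rotate (triangle-reflect C-symmetric (triangle-ordered b≤a a≤c)))
  ... | inj₂ b≤a | inj₁ b≤c | inj₂ c≤a = triangle-rotate (triangle-rotate (triangle-ordered b≤c c≤a))
  ... | inj₂ b≤a | inj₂ c≤b | _        = triangle-rotate (triangle-reflect C-symmetric (triangle-ordered c≤b b≤a))

  dist₀ : ℕ → ℕ
  dist₀ t = t ⊓ (n ∸ t)

  dist₀-step : ∀ t → dist₀ t ≤ suc (dist₀ (suc t)) × dist₀ (suc t) ≤ suc (dist₀ t)
  dist₀-step t =
    ⊓-mono-≤ (≤-trans (n≤1+n t) (n≤1+n (suc t))) (m∸n≤1+[m∸[1+n]] n t) ,
    ⊓-mono-≤ ≤-refl (m≤n⇒m≤1+n (∸-monoʳ-≤ n (n≤1+n t)))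

  dist₀-wrap : ∀ {t} → t ≤ n → dist₀ (t % n) ≡ dist₀ t
  dist₀-wrap t≤n with m≤n⇒m<n∨m≡n t≤n
  ... | inj₁ t<n = cong dist₀ (m<n⇒m%n≡m t<n)
  ... | inj₂ refl = trans (cong dist₀ (n%n≡0 n)) (sym (trans (cong (n ⊓_) (n∸n≡0 n)) (⊓-zeroʳ n)))

  dist₀-successor : ∀ {u v : Fin n} → toℕ v ≡ (toℕ u + 1) % n → dist₀ (toℕ v) ≡ dist₀ (suc (toℕ u))
  dist₀-successor {u} eq = trans (cong dist₀ (trans eq (cong (_% n) (+-comm (toℕ u) 1)))) (dist₀-wrap (toℕ<n u))

  dist₀-lipschitz : Lipschitz (C n) (λ u → dist₀ (toℕ u))
  dist₀-lipschitz {u} {w} (inj₁ p) =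
    subst (_≤ suc (dist₀ (toℕ w))) (sym (dist₀-successor p)) (proj₂ (dist₀-step (toℕ w)))
  dist₀-lipschitz {u} {w} (inj₂ p) =
    subst (λ t → dist₀ (toℕ u) ≤ suc t) (sym (dist₀-successor p)) (proj₁ (dist₀-step (toℕ u)))

  torus-triangle : ∀ u v w → Triangle (C n □ C n) (n + n) u v w
  torus-triangle (a₁ , b₁) (a₂ , b₂) (a₃ , b₃) = triangle-□ (cycle-triangle a₁ a₂ a₃) (cycle-triangle b₁ b₂ b₃)

  dist₀² : Fin n × Fin n → ℕ
  dist₀² (a , b) = dist₀ (toℕ a) + dist₀ (toℕ b)

  dist₀²-lipschitz : Lipschitz (C n □ C n) dist₀²
  dist₀²-lipschitz = lipschitz-□ {f = λ a → dist₀ (toℕ a)} {g = λ b → dist₀ (toℕ b)} dist₀-lipschitz dist₀-lipschitz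

  diam-≥-dist₀ : ∀ {D} → IsDiam (C n □ C n) D → ∀ a b → dist₀ (toℕ a) + dist₀ (toℕ b) ≤ D
  diam-≥-dist₀ {D} diam a b =
    ≤-trans (lipschitz-diam dist₀²-lipschitz diam (a , b) (origin , origin))
            (≤-reflexive (trans (cong (λ t → D + (t + t)) dist₀-origin) (+-identityʳ D)))
    where
    origin : Fin n
    origin = fromℕ< (>-nonZero⁻¹ n)
    dist₀-origin : dist₀ (toℕ origin) ≡ 0
    dist₀-origin = cong dist₀ (toℕ-fromℕ< _)

a≤m+∣n-o∣⇒a+o≤m+n : ∀ {a m n o} → o ≤ n → a ≤ m + ∣ n - o ∣ → a + o ≤ m + n
a≤m+∣n-o∣⇒a+o≤m+n {a} {m} {n} {o} o≤n a≤ = begin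
  a + o               ≤⟨ +-monoˡ-≤ o a≤ ⟩
  m + ∣ n - o ∣ + o   ≡⟨ cong (λ t → m + t + o) (m≤n⇒∣n-m∣≡n∸m o≤n) ⟩
  m + (n ∸ o) + o     ≡⟨ +-assoc m (n ∸ o) o ⟩
  m + (n ∸ o + o)     ≡⟨ cong (m +_) (m∸n+n≡m o≤n) ⟩
  m + n               ∎
  where open ≤-Reasoning

third-side-< : ∀ {k m₁ m₂ m₃} → m₁ + m₂ + m₃ ≤ 2 * k + 2 * k → 3 * k < m₁ + m₂ → m₃ < k
third-side-< {k} {m₁} {m₂} {m₃} perimeter long = +-cancelˡ-≤ (3 * k) _ _ (begin
  3 * k + suc m₃       ≡⟨ +-suc (3 * k) m₃ ⟩
  suc (3 * k) + m₃     ≤⟨ +-monoˡ-≤ m₃ long ⟩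
  m₁ + m₂ + m₃         ≤⟨ perimeter ⟩
  2 * k + 2 * k        ≡⟨ 2k+2k≡3k+k k ⟩
  3 * k + k            ∎)
  where
  open ≤-Reasoning
  2k+2k≡3k+k : ∀ k → 2 * k + 2 * k ≡ 3 * k + k
  2k+2k≡3k+k = solve-∀

skip-gap : ∀ {k D m₁ m₂ m₃ x y z} → 2 * k ≤ D → m₁ + m₂ + m₃ ≤ 2 * k + 2 * k →
           suc D + y ≤ m₁ + x → suc D + z ≤ m₂ + y → suc D + z ≤ m₃ + x → k + 2 + z ≤ x
skip-gap {k} {D} {m₁} {m₂} {m₃} {x} {y} {z} 2k≤D perimeter xy yz zx with m₁ + m₂ ≤? 3 * k
... | yes short = +-cancelˡ-≤ (3 * k) _ _ (begin
  3 * k + (k + 2 + z)       ≡⟨ 3k+[k+2+z]≡2+[2k+2k]+z k z ⟩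
  2 + (2 * k + 2 * k) + z   ≤⟨ +-monoˡ-≤ z (+-monoʳ-≤ 2 (+-mono-≤ 2k≤D 2k≤D)) ⟩
  2 + D + D + z             ≤⟨ +-cancelʳ-≤ y _ _ (begin
    2 + D + D + z + y           ≡⟨ 2+D+D+z+y≡[1+D+y]+[1+D+z] D z y ⟩
    (suc D + y) + (suc D + z)   ≤⟨ +-mono-≤ xy yz ⟩
    (m₁ + x) + (m₂ + y)         ≡⟨ a+x+[b+y]≡a+b+x+y m₁ m₂ x y ⟩
    m₁ + m₂ + x + y             ∎) ⟩
  m₁ + m₂ + x               ≤⟨ +-monoˡ-≤ x short ⟩
  3 * k + x                 ∎)
  where
  open ≤-Reasoning
  3k+[k+2+z]≡2+[2k+2k]+z : ∀ k z → 3 * k + (k + 2 + z) ≡ 2 + (2 * k + 2 * k) + z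
  3k+[k+2+z]≡2+[2k+2k]+z = solve-∀
  2+D+D+z+y≡[1+D+y]+[1+D+z] : ∀ D z y → 2 + D + D + z + y ≡ (suc D + y) + (suc D + z)
  2+D+D+z+y≡[1+D+y]+[1+D+z] = solve-∀
  a+x+[b+y]≡a+b+x+y : ∀ a b x y → a + x + (b + y) ≡ a + b + x + y
  a+x+[b+y]≡a+b+x+y = solve-∀
... | no long = +-cancelʳ-≤ k _ _ (begin
  k + 2 + z + k             ≡⟨ k+2+z+k≡1+2k+z+1 k z ⟩
  suc (2 * k) + z + 1       ≤⟨ +-monoˡ-≤ 1 (+-monoˡ-≤ z (s≤s 2k≤D)) ⟩
  suc D + z + 1             ≤⟨ +-monoˡ-≤ 1 zx ⟩
  m₃ + x + 1                ≡⟨ m+x+1≡x+[1+m] m₃ x ⟩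
  x + suc m₃                ≤⟨ +-monoʳ-≤ x m₃<k ⟩
  x + k                     ∎)
  where
  open ≤-Reasoning
  k+2+z+k≡1+2k+z+1 : ∀ k z → k + 2 + z + k ≡ suc (2 * k) + z + 1
  k+2+z+k≡1+2k+z+1 = solve-∀
  m+x+1≡x+[1+m] : ∀ m x → m + x + 1 ≡ x + suc m
  m+x+1≡x+[1+m] = solve-∀
  m₃<k : m₃ < k
  m₃<k = third-side-< {m₁ = m₁} perimeter (≰⇒> long)

module Radio {V : Set} {E : Graph V} {D : ℕ} (diam : IsDiam E D)
             {c : V → ℕ} (radio : IsRadioLabeling E D c) where

  distance : ∀ u v → ∃[ m ] IsDist E u v m
  distance u v with m , d , _ ← proj₁ diam u v = m , d

  radio-injective : ∀ {u v} → u ≢ v → c u ≢ c v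
  radio-injective {u} {v} u≢v cu≡cv with m , d , m≤D ← proj₁ diam u v =
    1+n≰n (begin
      suc D             ≤⟨ proj₂ radio u v u≢v m d ⟩
      m + ∣ c u - c v ∣ ≡⟨ cong (m +_) (m≡n⇒∣m-n∣≡0 cu≡cv) ⟩
      m + 0             ≡⟨ +-identityʳ m ⟩
      m                 ≤⟨ m≤D ⟩
      D                 ∎)
    where open ≤-Reasoning

  label-<⇒≢ : ∀ {u v} → c v < c u → u ≢ v
  label-<⇒≢ cv<cu refl = <-irrefl refl cv<cu

  radio-skip : ∀ {k} → 2 * k ≤ D → (∀ u v w → Triangle E (2 * k + 2 * k) u v w) →
               ∀ {x y z} → c z < c y → c y < c x → k + 2 + c z ≤ c x
  radio-skip 2k≤D triangles {x} {y} {z} z<y y<x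
    with m₁ , d₁ ← distance x y | m₂ , d₂ ← distance y z | m₃ , d₃ ← distance z x =
    skip-gap 2k≤D (triangle-distances (triangles x y z) d₁ d₂ d₃)
      (a≤m+∣n-o∣⇒a+o≤m+n (<⇒≤ y<x) (proj₂ radio x y (label-<⇒≢ y<x) m₁ d₁))
      (a≤m+∣n-o∣⇒a+o≤m+n (<⇒≤ z<y) (proj₂ radio y z (label-<⇒≢ z<y) m₂ d₂))
      (a≤m+∣n-o∣⇒a+o≤m+n (<⇒≤ z<x) (subst (λ t → suc D ≤ m₃ + t) (∣-∣-comm (c z) (c x))
        (proj₂ radio z x (≢-sym (label-<⇒≢ z<x)) m₃ d₃)))
    where
    z<x : c z < c x
    z<x = <-trans z<y y<x

2+[[n∸2]/2+[n∸2]/2]≤n : ∀ {n} → 2 ≤ n → 2 + ((n ∸ 2) / 2 + (n ∸ 2) / 2) ≤ n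
2+[[n∸2]/2+[n∸2]/2]≤n {n} 2≤n = begin
  2 + (j + j)   ≡⟨ cong (λ t → 2 + (j + t)) (+-identityʳ j) ⟨
  2 + 2 * j     ≡⟨ cong (2 +_) (*-comm 2 j) ⟩
  2 + j * 2     ≤⟨ +-monoʳ-≤ 2 (m/n*n≤m (n ∸ 2) 2) ⟩
  2 + (n ∸ 2)   ≡⟨ m+[n∸m]≡n 2≤n ⟩
  n             ∎
  where
  open ≤-Reasoning
  j = (n ∸ 2) / 2

[1+m]+[1+m]≤2+n⇒m+m≤n : ∀ {m n} → suc m + suc m ≤ suc (suc n) → m + m ≤ n
[1+m]+[1+m]≤2+n⇒m+m≤n {m} {n} len = s≤s⁻¹ (subst (_≤ suc n) (+-suc m m) (s≤s⁻¹ len))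

module _ {V : Set} (c : V → ℕ) where

  ∈⇒≤foldr-⊔ : ∀ {v} L → v ∈ L → c v ≤ foldr _⊔_ 0 (map c L)
  ∈⇒≤foldr-⊔ (u ∷ L) (here refl) = m≤m⊔n (c u) _
  ∈⇒≤foldr-⊔ (u ∷ L) (there v∈L) = ≤-trans (∈⇒≤foldr-⊔ L v∈L) (m≤n⊔m (c u) _)

  Increasing : List V → Set
  Increasing = Linked (λ u v → c u < c v)

  module _ {B : ℕ} (skip : ∀ {x y z} → c z < c y → c y < c x → B + c z ≤ c x) where

    skip-chain : ∀ j {z} rest → j + j ≤ length rest → Increasing (z ∷ rest) →
                 ∃[ v ] v ∈ z ∷ rest × j * B + c z ≤ c v
    skip-chain zero {z} rest _ _ = z , here refl , ≤-refl
    skip-chain (suc j) (y ∷ []) (s≤s len) _ with () ← m+n≤o⇒n≤o j len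
    skip-chain (suc j) {z} (y ∷ x ∷ rest) len (z<y ∷ y<x ∷ increasing)
      with v , v∈ , bound ← skip-chain j rest ([1+m]+[1+m]≤2+n⇒m+m≤n len) increasing =
      v , there (there v∈) , (begin
        (B + j * B) + c z   ≡⟨ +-assoc B (j * B) (c z) ⟩
        B + (j * B + c z)   ≡⟨ x∙yz≈y∙xz B (j * B) (c z) ⟩
        j * B + (B + c z)   ≤⟨ +-monoʳ-≤ (j * B) (skip z<y y<x) ⟩
        j * B + c x         ≤⟨ bound ⟩
        c v                 ∎)
      where open ≤-Reasoning

    increasing-top : (∀ v → 1 ≤ c v) → ∀ j xs → 2 + (j + j) ≤ length xs → Increasing xs →
                     ∃[ v ] v ∈ xs × j * B + 2 ≤ c v
    increasing-top positive j (w ∷ z ∷ rest) (s≤s (s≤s len)) (w<z ∷ increasing)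
      with v , v∈ , bound ← skip-chain j rest len increasing =
      v , there v∈ , ≤-trans (+-monoʳ-≤ (j * B) (≤-trans (s≤s (positive w)) w<z)) bound

  module _ (injective : ∀ {u v} → u ≢ v → c u ≢ c v) where

    open Sort (On.decTotalOrder ≤-decTotalOrder c) using (sort; sort-↭; sort-↗)

    increasing-sort : ∀ L → Unique L → Increasing (sort L)
    increasing-sort L unique = strict (sort-↗ L) (Permutationₛ.Unique-resp-↭ (setoid V) (↭⇒↭ₛ (↭-sym (sort-↭ L))) unique)
      where
      strict : ∀ {xs} → Linked (λ u v → c u ≤ c v) xs → Unique xs → Increasing xs
      strict [] _ = []
      strict [-] _ = [-]
      strict (u≤v ∷ nondecreasing) ((u≢v ∷ _) ∷ unique) = ≤∧≢⇒< u≤v (injective u≢v) ∷ strict nondecreasing unique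

    span-≥ : ∀ {B} → (∀ {x y z} → c z < c y → c y < c x → B + c z ≤ c x) → (∀ v → 1 ≤ c v) →
             ∀ {L} → Unique L → 2 ≤ length L → (length L ∸ 2) / 2 * B + 2 ≤ foldr _⊔_ 0 (map c L)
    span-≥ skip positive {L} unique 2≤|L|
      with v , v∈ , bound ← increasing-top skip positive ((length L ∸ 2) / 2) (sort L)
                              (subst (_ ≤_) (sym (↭-length (sort-↭ L))) (2+[[n∸2]/2+[n∸2]/2]≤n 2≤|L|))
                              (increasing-sort L unique) =
      ≤-trans bound (∈⇒≤foldr-⊔ L (∈-resp-↭ (sort-↭ L) v∈))

length-cartesianProductWith : ∀ {A B C : Set} (f : A → B → C) xs ys →
  length (cartesianProductWith f xs ys) ≡ length xs * length ys
length-cartesianProductWith f [] ys = refl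
length-cartesianProductWith f (x ∷ xs) ys =
  trans (length-++ (map (f x) ys)) (cong₂ _+_ (length-map (f x) ys) (length-cartesianProductWith f xs ys))

length-torusVertices : ∀ n → length (torusVertices n) ≡ n * n
length-torusVertices n =
  trans (length-cartesianProductWith _,_ (allFin n) (allFin n)) (cong₂ _*_ (length-tabulate {n = n} id) (length-tabulate {n = n} id))

torus-diam-≥ : ∀ k .{{_ : NonZero k}} {D} → IsDiam (C (2 * k) □ C (2 * k)) D → 2 * k ≤ D
torus-diam-≥ k {D} diam = subst (_≤ D) (trans (cong₂ _+_ dist₀-k dist₀-k) (cong (k +_) (sym (+-identityʳ k))))
                                 (diam-≥-dist₀ diam middle middle)
  where
  open Cycle (2 * k)
  middle : Fin (2 * k)
  middle = fromℕ< (subst (k <_) (*-comm k 2) (m<m*n k 2 ≤-refl))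
  dist₀-k : dist₀ (toℕ middle) ≡ k
  dist₀-k = begin
    dist₀ (toℕ middle)  ≡⟨ cong dist₀ (toℕ-fromℕ< _) ⟩
    k ⊓ (2 * k ∸ k)     ≡⟨ cong (k ⊓_) (trans (m+n∸m≡n k (k + 0)) (+-identityʳ k)) ⟩
    k ⊓ k               ≡⟨ ⊓-idem k ⟩
    k                   ∎
    where open ≡-Reasoning

theorem2p3 : (k : ℕ) → .{{_ : NonZero k}} → (D : ℕ)
           → IsDiam (C (2 * k) □ C (2 * k)) D
           → (c : Fin (2 * k) × Fin (2 * k) → ℕ)
           → IsRadioLabeling (C (2 * k) □ C (2 * k)) D c
           → ((2 * k) * (2 * k) ∸ 2) / 2 * (k + 2) + 2 ≤ torusSpan (2 * k) c
theorem2p3 k D diam c radio@(positive , _) =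
  subst (λ N → (N ∸ 2) / 2 * (k + 2) + 2 ≤ torusSpan n c) (length-torusVertices n)
    (span-≥ c radio-injective (radio-skip (torus-diam-≥ k diam) torus-triangle) positive
      (cartesianProduct⁺ (allFin⁺ n) (allFin⁺ n)) (subst (2 ≤_) (sym (length-torusVertices n)) 2≤n*n))
  where
  n = 2 * k
  open Cycle n using (torus-triangle)
  open Radio diam radio
  2≤n*n : 2 ≤ n * n
  2≤n*n = ≤-trans (m≤m*n 2 k) (m≤m*n n n)
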